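{- Every positive integer $m$ is a sum of four squares of integers. Moreover, if $m$ is a positive integer and $A$ is an integer such that $mA = F^2 + G^2 + H^2 + K^2$ for some integers $F, G, H, K$, then there exist integers $a, b, c, d$ and $x, y, z, v$ such that $$ m = a^2 + b^2 + c^2 + d^2, \qquad A = x^2 + y^2 + z^2 + v^2, $$ and $$ M[F,G,H,K] = M[a,b,c,d]^{T}\, M[x,y,z,v], $$ where $M[\cdot]$ is the matrix defined in the context and $^{T}$ denotes the transpose.
   Context: For integers $a,b,c,d$ define the $4\times 4$ integer matrix $$ M[a,b,c,d] = \begin{pmatrix} a & b & c & d \\ -b & a & d & -c \\ -c & -d & a & b \\ -d & c & -b & a \end{pmatrix}. $$ "Sum of four squares" allows some of the squares to be $0$. -}

module Defs where

open import Data.Integer using (ℤ; _+_; _*_; -_; +_; _>_)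
open import Data.Fin using (Fin; zero; suc)
open import Data.Product using (Σ; _×_; _,_; ∃)
open import Relation.Binary.PropositionalEquality using (_≡_)

-- 4x4 integer matrices, as functions of (row, column)
Mat4 : Set
Mat4 = Fin 4 → Fin 4 → ℤ

i0 i1 i2 i3 : Fin 4
i0 = zero
i1 = suc zero
i2 = suc (suc zero)
i3 = suc (suc (suc zero))

mat : ℤ → ℤ → ℤ → ℤ →
      ℤ → ℤ → ℤ → ℤ →
      ℤ → ℤ → ℤ → ℤ →
      ℤ → ℤ → ℤ → ℤ → Mat4
mat a00 a01 a02 a03 a10 a11 a12 a13 a20 a21 a22 a23 a30 a31 a32 a33 = f
  where
  row : ℤ → ℤ → ℤ → ℤ → Fin 4 → ℤ
  row x0 x1 x2 x3 zero = x0
  row x0 x1 x2 x3 (suc zero) = x1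
  row x0 x1 x2 x3 (suc (suc zero)) = x2
  row x0 x1 x2 x3 (suc (suc (suc zero))) = x3
  f : Mat4
  f zero = row a00 a01 a02 a03
  f (suc zero) = row a10 a11 a12 a13
  f (suc (suc zero)) = row a20 a21 a22 a23
  f (suc (suc (suc zero))) = row a30 a31 a32 a33

M : ℤ → ℤ → ℤ → ℤ → Mat4
M a b c d = mat
  a       b       c       d
  (- b)   a       d       (- c)
  (- c)   (- d)   a       b
  (- d)   c       (- b)   a

transpose : Mat4 → Mat4
transpose P i j = P j i

_⊗_ : Mat4 → Mat4 → Mat4
(P ⊗ Q) i j = P i i0 * Q i0 j + P i i1 * Q i1 j + P i i2 * Q i2 j + P i i3 * Q i3 j

_≡ₘ_ : Mat4 → Mat4 → Set
P ≡ₘ Q = ∀ i j → P i j ≡ Q i j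

sq : ℤ → ℤ
sq x = x * x

SumOfFourSquares : ℤ → Set
SumOfFourSquares n = ∃ λ a → ∃ λ b → ∃ λ c → ∃ λ d →
  n ≡ sq a + sq b + sq c + sq d

module Submission where

-- Read (a, b, c, d) as the integer quaternion a + bi + cj + dk.  Then M[q] is the matrix of
-- right multiplication by q on row vectors and M[q̄] = M[q]ᵀ, so the matrix identity says
-- F + Gi + Hj + Kk = ā x, and the norm N q = a² + b² + c² + d² is multiplicative.  We prove by
-- strong induction on m that m is a norm and that every q with m ∣ N q splits as q = ᾱ β with
-- N α = m (then A = N β).
--
-- Splitting, given that every k < m is a norm and splits: write q = r + m t with coordinates
-- |rᵢ| ≤ m/2.  Then N r = k m with k < m, unless every rᵢ = m/2.  If k = 0 then r = 0 and
-- q = ᾱ (α t) for any α of norm m.  If 0 < k < m, splitting r̄ with respect to k gives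
-- r = δ̄ γ with N δ = m, hence q = δ̄ (γ + δ t).  In the boundary case m = 2n and
-- r = n (1 + i + j + k) = conj (γ ρ) · γ ε for any γ of norm n, where ρ = 1 + i and ε = i + j.
--
-- m is a norm: for composite m by multiplicativity; for a prime p, pigeonhole on squares
-- modulo p gives p ∣ 1 + x² + y², and splitting 1 + xi + yj yields a factor of norm p (it is
-- not ≡ 0 modulo p).

open import Defs
open import Data.Product using (∃; ∃₂; _×_; _,_; proj₁; proj₂)
open import Data.Sum as Sum using (_⊎_; inj₁; inj₂; [_,_]′)
open import Data.Empty using (⊥-elim)
open import Data.List using (_∷_; [])
open import Function using (_∘_; case_of_)
open import Relation.Binary.PropositionalEquality
open import Relation.Binary.Definitions using (tri<; tri≈; tri>)
open import Relation.Nullary using (yes; no)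
open ≡-Reasoning

module Natural where
  open import Data.Nat
  open import Data.Nat.Properties
  open import Data.Nat.DivMod using (_%_; _/_; _mod_; m≡m%n+[m/n]*n; m%n<n)
  open import Data.Nat.Divisibility using (_∣_; _∤_; divides; ∣⇒≤)
  open import Data.Nat.Primality using (Prime; euclidsLemma; prime⇒nonZero)
  open import Data.Nat.Tactic.RingSolver using (solve-∀)
  open import Data.Fin using (Fin; toℕ; splitAt; join; opposite)
  open import Data.Fin.Properties as Finₚ
    using (pigeonhole; join-splitAt; toℕ-injective; toℕ-fromℕ<; toℕ<n; opposite-prop; opposite-involutive)
  open import Function.Definitions using (Injective)

  ⌊n/2⌋+⌊n/2⌋≤n : ∀ n → ⌊ n /2⌋ + ⌊ n /2⌋ ≤ n
  ⌊n/2⌋+⌊n/2⌋≤n zero          = z≤n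
  ⌊n/2⌋+⌊n/2⌋≤n (suc zero)    = z≤n
  ⌊n/2⌋+⌊n/2⌋≤n (suc (suc n)) =
    s≤s (subst (_≤ suc n) (sym (+-suc ⌊ n /2⌋ ⌊ n /2⌋)) (s≤s (⌊n/2⌋+⌊n/2⌋≤n n)))

  n<[1+⌊n/2⌋]+[1+⌊n/2⌋] : ∀ n → n < suc ⌊ n /2⌋ + suc ⌊ n /2⌋
  n<[1+⌊n/2⌋]+[1+⌊n/2⌋] zero          = s≤s z≤n
  n<[1+⌊n/2⌋]+[1+⌊n/2⌋] (suc zero)    = s≤s (s≤s z≤n)
  n<[1+⌊n/2⌋]+[1+⌊n/2⌋] (suc (suc n)) =
    s≤s (subst (suc n <_) (sym (+-suc (suc ⌊ n /2⌋) (suc ⌊ n /2⌋))) (s≤s (n<[1+⌊n/2⌋]+[1+⌊n/2⌋] n)))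

  %≡%⇒∣∸ : ∀ m n {p} .{{_ : NonZero p}} → m % p ≡ n % p → p ∣ m ∸ n
  %≡%⇒∣∸ m n {p} eq = divides (m / p ∸ n / p) (begin
    m ∸ n                                     ≡⟨ cong₂ _∸_ (m≡m%n+[m/n]*n m p) (m≡m%n+[m/n]*n n p) ⟩
    (m % p + m / p * p) ∸ (n % p + n / p * p) ≡⟨ cong (λ r → (r + m / p * p) ∸ (n % p + n / p * p)) eq ⟩
    (n % p + m / p * p) ∸ (n % p + n / p * p) ≡⟨ [m+n]∸[m+o]≡n∸o (n % p) (m / p * p) (n / p * p) ⟩
    m / p * p ∸ n / p * p                     ≡⟨ *-distribʳ-∸ p (m / p) (n / p) ⟨
    (m / p ∸ n / p) * p                       ∎)

  n≤m⇒m*m∸n*n≡[m∸n]*[m+n] : ∀ {m n} → n ≤ m → m * m ∸ n * n ≡ (m ∸ n) * (m + n)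
  n≤m⇒m*m∸n*n≡[m∸n]*[m+n] {m} {n} n≤m = begin
    m * m ∸ n * n                   ≡⟨ cong (λ x → x * x ∸ n * n) m≡n+d ⟩
    (n + d) * (n + d) ∸ n * n       ≡⟨ cong (_∸ n * n) (expand n d) ⟩
    n * n + d * (n + d + n) ∸ n * n ≡⟨ m+n∸m≡n (n * n) _ ⟩
    d * (n + d + n)                 ≡⟨ cong (λ x → d * (x + n)) m≡n+d ⟨
    d * (m + n)                     ∎
    where
    d = m ∸ n
    m≡n+d : m ≡ n + d
    m≡n+d = sym (m+[n∸m]≡n n≤m)
    expand : ∀ n d → (n + d) * (n + d) ≡ n * n + d * (n + d + n)
    expand = solve-∀

  0<n<p⇒p∤n : ∀ {p n} → 0 < n → n < p → p ∤ n
  0<n<p⇒p∤n 0<n n<p p∣n = <⇒≱ n<p (∣⇒≤ {{>-nonZero 0<n}} p∣n)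

  squares-incongruent : ∀ {p a b} .{{_ : NonZero p}} → Prime p → a < b → b + a < p → b * b % p ≢ a * a % p
  squares-incongruent {p} {a} {b} p-prime a<b b+a<p eq =
    [ 0<n<p⇒p∤n 0<b∸a (≤-<-trans (m∸n≤m b a) (≤-<-trans (m≤m+n b a) b+a<p))
    , 0<n<p⇒p∤n (<-≤-trans 0<b∸a (≤-trans (m∸n≤m b a) (m≤m+n b a))) b+a<p
    ]′ (euclidsLemma (b ∸ a) (b + a) p-prime
         (subst (p ∣_) (n≤m⇒m*m∸n*n≡[m∸n]*[m+n] (<⇒≤ a<b)) (%≡%⇒∣∸ (b * b) (a * a) eq)))
    where
    0<b∸a : 0 < b ∸ a
    0<b∸a = m<n⇒0<n∸m a<b

  square-mod-injective : ∀ {p h a b} .{{_ : NonZero p}} → Prime p → h + h ≤ p → a ≤ h → b ≤ h →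
                         a * a % p ≡ b * b % p → a ≡ b
  square-mod-injective p-prime h+h≤p a≤h b≤h eq with <-cmp _ _
  ... | tri< a<b _ _ = ⊥-elim (squares-incongruent p-prime a<b
                         (<-≤-trans (+-mono-≤-< b≤h (<-≤-trans a<b b≤h)) h+h≤p) (sym eq))
  ... | tri≈ _ a≡b _ = a≡b
  ... | tri> _ _ b<a = ⊥-elim (squares-incongruent p-prime b<a
                         (<-≤-trans (+-mono-≤-< a≤h (<-≤-trans b<a a≤h)) h+h≤p) eq)

  injections-collide : ∀ {m n} → m < n + n → (f g : Fin n → Fin m) →
                       Injective _≡_ _≡_ f → Injective _≡_ _≡_ g → ∃₂ λ a b → f a ≡ g b
  injections-collide {n = n} m<n+n f g f-inj g-inj with pigeonhole m<n+n ([ f , g ]′ ∘ splitAt n)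
  ... | i , j , i<j , fi≡fj = meet (splitAt n i) (splitAt n j) (Finₚ.<⇒≢ i<j ∘ splitAt-injective) fi≡fj
    where
    splitAt-injective : splitAt n i ≡ splitAt n j → i ≡ j
    splitAt-injective e = trans (sym (join-splitAt n n i)) (trans (cong (join n n) e) (join-splitAt n n j))
    meet : ∀ u v → u ≢ v → [ f , g ]′ u ≡ [ f , g ]′ v → ∃₂ λ a b → f a ≡ g b
    meet (inj₁ a) (inj₁ b) u≢v e = ⊥-elim (u≢v (cong inj₁ (f-inj e)))
    meet (inj₁ a) (inj₂ b) _   e = a , b , e
    meet (inj₂ a) (inj₁ b) _   e = b , a , sym e
    meet (inj₂ a) (inj₂ b) u≢v e = ⊥-elim (u≢v (cong inj₂ (g-inj e)))

  m%p+n%p+1≡p⇒p∣m+n+1 : ∀ m n {p} .{{_ : NonZero p}} → m % p + suc (n % p) ≡ p → p ∣ m + n + 1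
  m%p+n%p+1≡p⇒p∣m+n+1 m n {p} e = divides (suc (m / p + n / p)) (begin
    m + n + 1                                   ≡⟨ cong₂ (λ u v → u + v + 1) (m≡m%n+[m/n]*n m p) (m≡m%n+[m/n]*n n p) ⟩
    m % p + m / p * p + (n % p + n / p * p) + 1 ≡⟨ regroup (m % p) (n % p) (m / p) (n / p) p ⟩
    m % p + (1 + n % p) + (m / p + n / p) * p   ≡⟨ cong (_+ (m / p + n / p) * p) e ⟩
    p + (m / p + n / p) * p                     ∎)
    where
    regroup : ∀ s t u v p → s + u * p + (t + v * p) + 1 ≡ s + (1 + t) + (u + v) * p
    regroup = solve-∀

  prime⇒∣x²+y²+1 : ∀ {p} → Prime p → ∃₂ λ x y → p ∣ x * x + y * y + 1
  prime⇒∣x²+y²+1 {p} p-prime = two-squares (injections-collide (n<[1+⌊n/2⌋]+[1+⌊n/2⌋] p)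
    square (opposite ∘ square) square-injective (square-injective ∘ opposite-injective))
    where
    instance _ = prime⇒nonZero p-prime
    square : Fin (suc ⌊ p /2⌋) → Fin p
    square a = (toℕ a * toℕ a) mod p
    toℕ-square : ∀ a → toℕ (square a) ≡ toℕ a * toℕ a % p
    toℕ-square a = toℕ-fromℕ< (m%n<n (toℕ a * toℕ a) p)
    square-injective : Injective _≡_ _≡_ square
    square-injective {a} {b} e = toℕ-injective (square-mod-injective p-prime (⌊n/2⌋+⌊n/2⌋≤n p)
      (s≤s⁻¹ (toℕ<n a)) (s≤s⁻¹ (toℕ<n b)) (trans (sym (toℕ-square a)) (trans (cong toℕ e) (toℕ-square b))))
    opposite-injective : ∀ {i j : Fin p} → opposite i ≡ opposite j → i ≡ j
    opposite-injective {i} {j} e =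
      trans (sym (opposite-involutive i)) (trans (cong opposite e) (opposite-involutive j))
    -- opposite x = p - 1 - x, so square a ≡ opposite (square b) means a² + b² + 1 ≡ 0 (mod p).
    two-squares : (∃₂ λ a b → square a ≡ opposite (square b)) → ∃₂ λ x y → p ∣ x * x + y * y + 1
    two-squares (a , b , e) = toℕ a , toℕ b , m%p+n%p+1≡p⇒p∣m+n+1 _ _ (begin
      toℕ a * toℕ a % p + suc t   ≡⟨ cong (_+ suc t) (trans (sym (toℕ-square a)) (cong toℕ e)) ⟩
      toℕ (opposite (square b)) + suc t
        ≡⟨ cong (_+ suc t) (trans (opposite-prop (square b)) (cong (λ x → p ∸ suc x) (toℕ-square b))) ⟩
      p ∸ suc t + suc t            ≡⟨ m∸n+n≡m (m%n<n (toℕ b * toℕ b) p) ⟩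
      p                            ∎)
      where
      t = toℕ b * toℕ b % p

  +-mono-<-one-of-four : ∀ {a b c d n} → a ≤ n → b ≤ n → c ≤ n → d ≤ n →
                         a < n ⊎ b < n ⊎ c < n ⊎ d < n → a + b + c + d < n + n + n + n
  +-mono-<-one-of-four a≤ b≤ c≤ d≤ (inj₁ a<)               = +-mono-<-≤ (+-mono-<-≤ (+-mono-<-≤ a< b≤) c≤) d≤
  +-mono-<-one-of-four a≤ b≤ c≤ d≤ (inj₂ (inj₁ b<))        = +-mono-<-≤ (+-mono-<-≤ (+-mono-≤-< a≤ b<) c≤) d≤
  +-mono-<-one-of-four a≤ b≤ c≤ d≤ (inj₂ (inj₂ (inj₁ c<))) = +-mono-<-≤ (+-mono-≤-< (+-mono-≤ a≤ b≤) c<) d≤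
  +-mono-<-one-of-four a≤ b≤ c≤ d≤ (inj₂ (inj₂ (inj₂ d<))) = +-mono-≤-< (+-mono-≤ (+-mono-≤ a≤ b≤) c≤) d<

  four-squares-< : ∀ {m} a b c d → a + a ≤ m → b + b ≤ m → c + c ≤ m → d + d ≤ m →
                   a + a < m ⊎ b + b < m ⊎ c + c < m ⊎ d + d < m →
                   a * a + b * b + c * c + d * d < m * m
  four-squares-< {m} a b c d a≤ b≤ c≤ d≤ one-strict = *-cancelˡ-< 4 _ _
    (subst₂ _<_ (quadruple a b c d) (quadruple-square m)
      (+-mono-<-one-of-four (square-≤ a≤) (square-≤ b≤) (square-≤ c≤) (square-≤ d≤)
        (Sum.map square-< (Sum.map square-< (Sum.map square-< square-<)) one-strict)))
    where
    square-≤ : ∀ {x} → x ≤ m → x * x ≤ m * m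
    square-≤ x≤m = *-mono-≤ x≤m x≤m
    square-< : ∀ {x} → x < m → x * x < m * m
    square-< x<m = *-mono-< x<m x<m
    quadruple : ∀ a b c d → (a + a) * (a + a) + (b + b) * (b + b) + (c + c) * (c + c) + (d + d) * (d + d)
                            ≡ 4 * (a * a + b * b + c * c + d * d)
    quadruple = solve-∀
    quadruple-square : ∀ m → m * m + m * m + m * m + m * m ≡ 4 * (m * m)
    quadruple-square = solve-∀

open Natural using (prime⇒∣x²+y²+1; four-squares-<)

open import Data.Nat as ℕ using (ℕ; zero; suc; ⌊_/2⌋)
import Data.Nat.Properties as ℕ
open import Data.Nat.Divisibility as ℕ using (divides; divides-refl)
open import Data.Nat.Primality using (Prime; Composite; composite; prime?; ¬prime⇒composite; ¬prime[1])
open import Data.Nat.Induction using (<-rec)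
import Data.Nat.Tactic.RingSolver as ℕ-Solver
open import Data.Fin using (Fin; zero; suc)
open import Data.Integer using (ℤ; _+_; _*_; -_; +_; _>_; +<+; ∣_∣; -[1+_]; 0ℤ; 1ℤ; _%ℕ_; _/ℕ_)
open import Data.Integer.Properties
  using (neg-involutive; pos-*; pos-+; abs-*; ∣-i∣≡∣i∣; +-identityˡ; *-identityʳ; *-comm; *-cancelˡ-≡; *-cancelʳ-≡)
open import Data.Integer.DivMod using (a≡a%ℕn+[a/ℕn]*n; n%ℕd<d)
open import Data.Integer.Divisibility.Signed as Signed using (∣m+n∣n⇒∣m; ∣m⇒∣m*n; ∣⇒∣ᵤ)
open import Data.Integer.Tactic.RingSolver using (solve; solve-∀)

data Quaternion : Set where
  quat : ℤ → ℤ → ℤ → ℤ → Quaternion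

infixl 7 _·_ _⋆_
infixl 6 _⊕_
infix  4 _≃_

-- Hamilton's product for the orientation i j = -k, written so that p · q is literally the
-- first row of matrix p ⊗ matrix q.
_·_ : Quaternion → Quaternion → Quaternion
quat a b c d · quat x y z w = quat
  (a * x + b * (- y) + c * (- z) + d * (- w))
  (a * y + b * x + c * (- w) + d * z)
  (a * z + b * w + c * x + d * (- y))
  (a * w + b * (- z) + c * y + d * x)

_⊕_ : Quaternion → Quaternion → Quaternion
quat a b c d ⊕ quat x y z w = quat (a + x) (b + y) (c + z) (d + w)

_⋆_ : ℤ → Quaternion → Quaternion
n ⋆ quat x y z w = quat (n * x) (n * y) (n * z) (n * w)

conj : Quaternion → Quaternion
conj (quat a b c d) = quat a (- b) (- c) (- d)

norm : Quaternion → ℤ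
norm (quat a b c d) = sq a + sq b + sq c + sq d

real : ℤ → Quaternion
real n = quat n 0ℤ 0ℤ 0ℤ

diag : ℤ → Quaternion
diag n = quat n n n n

re : Quaternion → ℤ
re (quat a _ _ _) = a

matrix : Quaternion → Mat4
matrix (quat a b c d) = M a b c d

-- The identities below are stated componentwise, so that the ring solver sees each coordinate.
_≃_ : Quaternion → Quaternion → Set
quat a b c d ≃ quat x y z w = a ≡ x × b ≡ y × c ≡ z × d ≡ w

≃⇒≡ : ∀ {p q} → p ≃ q → p ≡ q
≃⇒≡ {quat _ _ _ _} {quat _ _ _ _} (refl , refl , refl , refl) = refl

real-injective : ∀ {m n} → real m ≡ real n → m ≡ n
real-injective refl = refl

·-assoc : ∀ p q r → (p · q) · r ≃ p · (q · r)
·-assoc (quat a b c d) (quat x y z w) (quat e f g h) = solve vs , solve vs , solve vs , solve vs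
  where vs = a ∷ b ∷ c ∷ d ∷ x ∷ y ∷ z ∷ w ∷ e ∷ f ∷ g ∷ h ∷ []

·-distribˡ-⊕ : ∀ p q r → p · (q ⊕ r) ≃ p · q ⊕ p · r
·-distribˡ-⊕ (quat a b c d) (quat x y z w) (quat e f g h) = solve vs , solve vs , solve vs , solve vs
  where vs = a ∷ b ∷ c ∷ d ∷ x ∷ y ∷ z ∷ w ∷ e ∷ f ∷ g ∷ h ∷ []

·-⋆ : ∀ n p q → p · (n ⋆ q) ≃ n ⋆ (p · q)
·-⋆ n (quat a b c d) (quat x y z w) = solve vs , solve vs , solve vs , solve vs
  where vs = n ∷ a ∷ b ∷ c ∷ d ∷ x ∷ y ∷ z ∷ w ∷ []

real-· : ∀ n q → real n · q ≃ n ⋆ q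
real-· n (quat x y z w) = solve vs , solve vs , solve vs , solve vs
  where vs = n ∷ x ∷ y ∷ z ∷ w ∷ []

⋆-real : ∀ m n → m ⋆ real n ≃ real (m * n)
⋆-real m n = refl , solve vs , solve vs , solve vs
  where vs = m ∷ n ∷ []

conj-involutive : ∀ p → conj (conj p) ≃ p
conj-involutive (quat a b c d) = refl , neg-involutive b , neg-involutive c , neg-involutive d

conj-· : ∀ p q → conj (p · q) ≃ conj q · conj p
conj-· (quat a b c d) (quat x y z w) = solve vs , solve vs , solve vs , solve vs
  where vs = a ∷ b ∷ c ∷ d ∷ x ∷ y ∷ z ∷ w ∷ []

norm-conj : ∀ p → norm (conj p) ≡ norm p
norm-conj (quat a b c d) = squares a b c d
  where
  squares : ∀ a b c d → a * a + - b * - b + - c * - c + - d * - d ≡ a * a + b * b + c * c + d * d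
  squares = solve-∀

conj-·-self : ∀ p → conj p · p ≃ real (norm p)
conj-·-self p@(quat a b c d) = norm-conj p , solve vs , solve vs , solve vs
  where vs = a ∷ b ∷ c ∷ d ∷ []

conj-·-· : ∀ p q → conj p · (p · q) ≡ norm p ⋆ q
conj-·-· p q = begin
  conj p · (p · q)  ≡⟨ ≃⇒≡ (·-assoc (conj p) p q) ⟨
  conj p · p · q    ≡⟨ cong (_· q) (≃⇒≡ (conj-·-self p)) ⟩
  real (norm p) · q ≡⟨ ≃⇒≡ (real-· (norm p) q) ⟩
  norm p ⋆ q        ∎

norm-· : ∀ p q → norm (p · q) ≡ norm p * norm q
norm-· p q = real-injective (begin
  real (norm (p · q))         ≡⟨ ≃⇒≡ (conj-·-self (p · q)) ⟨
  conj (p · q) · (p · q)      ≡⟨ cong (_· (p · q)) (≃⇒≡ (conj-· p q)) ⟩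
  conj q · conj p · (p · q)   ≡⟨ ≃⇒≡ (·-assoc (conj q) (conj p) (p · q)) ⟩
  conj q · (conj p · (p · q)) ≡⟨ cong (conj q ·_) (conj-·-· p q) ⟩
  conj q · (norm p ⋆ q)       ≡⟨ ≃⇒≡ (·-⋆ (norm p) (conj q) q) ⟩
  norm p ⋆ (conj q · q)       ≡⟨ cong (norm p ⋆_) (≃⇒≡ (conj-·-self q)) ⟩
  norm p ⋆ real (norm q)      ≡⟨ ≃⇒≡ (⋆-real (norm p) (norm q)) ⟩
  real (norm p * norm q)      ∎)

⊕-identityˡ : ∀ q → real 0ℤ ⊕ q ≡ q
⊕-identityˡ (quat x y z w) = ≃⇒≡ (+-identityˡ x , +-identityˡ y , +-identityˡ z , +-identityˡ w)

-- iₗ p, jₗ p and kₗ p are the products i · p, j · p and k · p: rows 1, 2 and 3 of matrix p.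
iₗ jₗ kₗ : Quaternion → Quaternion
iₗ (quat a b c d) = quat (- b) a d (- c)
jₗ (quat a b c d) = quat (- c) (- d) a b
kₗ (quat a b c d) = quat (- d) c (- b) a

iₗ-· : ∀ p q → iₗ (p · q) ≃ iₗ p · q
iₗ-· (quat a b c d) (quat x y z w) = solve vs , solve vs , solve vs , solve vs
  where vs = a ∷ b ∷ c ∷ d ∷ x ∷ y ∷ z ∷ w ∷ []

jₗ-· : ∀ p q → jₗ (p · q) ≃ jₗ p · q
jₗ-· (quat a b c d) (quat x y z w) = solve vs , solve vs , solve vs , solve vs
  where vs = a ∷ b ∷ c ∷ d ∷ x ∷ y ∷ z ∷ w ∷ []

kₗ-· : ∀ p q → kₗ (p · q) ≃ kₗ p · q
kₗ-· (quat a b c d) (quat x y z w) = solve vs , solve vs , solve vs , solve vs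
  where vs = a ∷ b ∷ c ∷ d ∷ x ∷ y ∷ z ∷ w ∷ []

row : Mat4 → Fin 4 → Quaternion
row P r = quat (P r i0) (P r i1) (P r i2) (P r i3)

rows-≃ : ∀ {P Q} → (∀ r → row P r ≃ row Q r) → P ≡ₘ Q
rows-≃ e r zero                   = proj₁ (e r)
rows-≃ e r (suc zero)             = proj₁ (proj₂ (e r))
rows-≃ e r (suc (suc zero))       = proj₁ (proj₂ (proj₂ (e r)))
rows-≃ e r (suc (suc (suc zero))) = proj₂ (proj₂ (proj₂ (e r)))

matrix-· : ∀ p q → matrix (p · q) ≡ₘ (matrix p ⊗ matrix q)
matrix-· p@(quat _ _ _ _) q@(quat _ _ _ _) = rows-≃ λ where
  zero                   → refl , refl , refl , refl
  (suc zero)             → iₗ-· p q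
  (suc (suc zero))       → jₗ-· p q
  (suc (suc (suc zero))) → kₗ-· p q

matrix-conj : ∀ p → matrix (conj p) ≡ₘ transpose (matrix p)
matrix-conj (quat a b c d) = rows-≃ λ where
  zero                   → refl , refl , refl , refl
  (suc zero)             → neg-involutive b , refl , refl , neg-involutive c
  (suc (suc zero))       → neg-involutive c , neg-involutive d , refl , refl
  (suc (suc (suc zero))) → neg-involutive d , refl , neg-involutive b , refl

⊗-congˡ : ∀ {P P′ Q} → P ≡ₘ P′ → (P ⊗ Q) ≡ₘ (P′ ⊗ Q)
⊗-congˡ e r s rewrite e r i0 | e r i1 | e r i2 | e r i3 = refl

matrix-conj-· : ∀ p q → matrix (conj p · q) ≡ₘ (transpose (matrix p) ⊗ matrix q)
matrix-conj-· p q r s = trans (matrix-· (conj p) q r s) (⊗-congˡ {Q = matrix q} (matrix-conj p) r s)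

sq≡∣∣² : ∀ x → sq x ≡ + (∣ x ∣ ℕ.* ∣ x ∣)
sq≡∣∣² (+ n)    = sym (pos-* n n)
sq≡∣∣² -[1+ n ] = refl

normℕ : Quaternion → ℕ
normℕ (quat a b c d) = ∣ a ∣ ℕ.* ∣ a ∣ ℕ.+ ∣ b ∣ ℕ.* ∣ b ∣ ℕ.+ ∣ c ∣ ℕ.* ∣ c ∣ ℕ.+ ∣ d ∣ ℕ.* ∣ d ∣

norm≡normℕ : ∀ q → norm q ≡ + normℕ q
norm≡normℕ (quat a b c d) = begin
  sq a + sq b + sq c + sq d
    ≡⟨ cong₂ _+_ (cong₂ _+_ (cong₂ _+_ (sq≡∣∣² a) (sq≡∣∣² b)) (sq≡∣∣² c)) (sq≡∣∣² d) ⟩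
  + A + + B + + C + + D     ≡⟨ cong (λ x → x + + C + + D) (pos-+ A B) ⟨
  + (A ℕ.+ B) + + C + + D   ≡⟨ cong (_+ + D) (pos-+ (A ℕ.+ B) C) ⟨
  + (A ℕ.+ B ℕ.+ C) + + D   ≡⟨ pos-+ (A ℕ.+ B ℕ.+ C) D ⟨
  + (A ℕ.+ B ℕ.+ C ℕ.+ D)   ∎
  where
  A = ∣ a ∣ ℕ.* ∣ a ∣
  B = ∣ b ∣ ℕ.* ∣ b ∣
  C = ∣ c ∣ ℕ.* ∣ c ∣
  D = ∣ d ∣ ℕ.* ∣ d ∣

normℕ≡0⇒≡0 : ∀ q → normℕ q ≡ 0 → q ≡ real 0ℤ
normℕ≡0⇒≡0 (quat a b c d) A+B+C+D≡0 = ≃⇒≡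
  ( zero-square a (ℕ.m+n≡0⇒m≡0 A A+B≡0)
  , zero-square b (ℕ.m+n≡0⇒n≡0 A A+B≡0)
  , zero-square c (ℕ.m+n≡0⇒n≡0 (A ℕ.+ B) A+B+C≡0)
  , zero-square d (ℕ.m+n≡0⇒n≡0 (A ℕ.+ B ℕ.+ C) A+B+C+D≡0))
  where
  A = ∣ a ∣ ℕ.* ∣ a ∣
  B = ∣ b ∣ ℕ.* ∣ b ∣
  C = ∣ c ∣ ℕ.* ∣ c ∣
  A+B+C≡0 : A ℕ.+ B ℕ.+ C ≡ 0
  A+B+C≡0 = ℕ.m+n≡0⇒m≡0 (A ℕ.+ B ℕ.+ C) A+B+C+D≡0
  A+B≡0 : A ℕ.+ B ≡ 0
  A+B≡0 = ℕ.m+n≡0⇒m≡0 (A ℕ.+ B) A+B+C≡0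
  zero-square : ∀ x → ∣ x ∣ ℕ.* ∣ x ∣ ≡ 0 → x ≡ 0ℤ
  zero-square (+ zero) _ = refl

Centred : ℕ → ℤ → Set
Centred m r = ∣ r ∣ ℕ.+ ∣ r ∣ ℕ.< m ⊎ (r ≡ + ⌊ m /2⌋ × ⌊ m /2⌋ ℕ.+ ⌊ m /2⌋ ≡ m)

centred-≤ : ∀ {m r} → Centred m r → ∣ r ∣ ℕ.+ ∣ r ∣ ℕ.≤ m
centred-≤ (inj₁ lt)         = ℕ.<⇒≤ lt
centred-≤ (inj₂ (refl , e)) = ℕ.≤-reflexive e

centred-residue : ∀ x m .{{_ : ℕ.NonZero m}} → ∃₂ λ r t → x ≡ r + + m * t × Centred m r
centred-residue x m = centre (x %ℕ m) (x /ℕ m) (n%ℕd<d x m)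
  (trans (a≡a%ℕn+[a/ℕn]*n x m) (cong (λ y → + (x %ℕ m) + y) (*-comm (x /ℕ m) (+ m))))
  where
  centre : ∀ s t → s ℕ.< m → x ≡ + s + + m * t → ∃₂ λ r t → x ≡ r + + m * t × Centred m r
  centre s t s<m x≡s+mt with ℕ.<-cmp (s ℕ.+ s) m
  ... | tri< s+s<m _ _ = + s , t , x≡s+mt , inj₁ s+s<m
  ... | tri≈ _ s+s≡m _ =
    + s , t , x≡s+mt , inj₂ (cong +_ (sym h≡s) , subst (λ h → h ℕ.+ h ≡ m) (sym h≡s) s+s≡m)
    where
    h≡s : ⌊ m /2⌋ ≡ s
    h≡s = trans (cong ⌊_/2⌋ (sym s+s≡m)) (sym (ℕ.n≡⌊n+n/2⌋ s))
  ... | tri> _ _ m<s+s = - + u , t + 1ℤ , x≡-u+m[t+1] , inj₁ u+u<m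
    where
    u = m ℕ.∸ s
    s+u≡m : s ℕ.+ u ≡ m
    s+u≡m = ℕ.m+[n∸m]≡n (ℕ.<⇒≤ s<m)
    u<s : u ℕ.< s
    u<s = ℕ.+-cancelˡ-< s u s (subst (ℕ._< s ℕ.+ s) (sym s+u≡m) m<s+s)
    u+u<m : ∣ - + u ∣ ℕ.+ ∣ - + u ∣ ℕ.< m
    u+u<m rewrite ∣-i∣≡∣i∣ (+ u) = subst (u ℕ.+ u ℕ.<_) s+u≡m (ℕ.+-monoˡ-< u u<s)
    +m≡+s++u : + m ≡ + s + + u
    +m≡+s++u = trans (cong +_ (sym s+u≡m)) (pos-+ s u)
    carry : ∀ S U t → S + (S + U) * t ≡ - U + (S + U) * (t + 1ℤ)
    carry = solve-∀
    x≡-u+m[t+1] : x ≡ - + u + + m * (t + 1ℤ)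
    x≡-u+m[t+1] = begin
      x                              ≡⟨ x≡s+mt ⟩
      + s + + m * t                  ≡⟨ cong (λ n → + s + n * t) +m≡+s++u ⟩
      + s + (+ s + + u) * t          ≡⟨ carry (+ s) (+ u) t ⟩
      - + u + (+ s + + u) * (t + 1ℤ) ≡⟨ cong (λ n → - + u + n * (t + 1ℤ)) +m≡+s++u ⟨
      - + u + + m * (t + 1ℤ)         ∎

Reduced : ℕ → Quaternion → Set
Reduced m r = normℕ r ℕ.< m ℕ.* m ⊎ (r ≡ diag (+ ⌊ m /2⌋) × ⌊ m /2⌋ ℕ.+ ⌊ m /2⌋ ≡ m)

reduced : ∀ {m} r₀ r₁ r₂ r₃ → Centred m r₀ → Centred m r₁ → Centred m r₂ → Centred m r₃ →
          Reduced m (quat r₀ r₁ r₂ r₃)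
reduced {m} r₀ r₁ r₂ r₃ c₀ c₁ c₂ c₃ = classify c₀ c₁ c₂ c₃
  where
  Strict : ℤ → Set
  Strict r = ∣ r ∣ ℕ.+ ∣ r ∣ ℕ.< m
  small : Strict r₀ ⊎ Strict r₁ ⊎ Strict r₂ ⊎ Strict r₃ → normℕ (quat r₀ r₁ r₂ r₃) ℕ.< m ℕ.* m
  small = four-squares-< (∣ r₀ ∣) (∣ r₁ ∣) (∣ r₂ ∣) (∣ r₃ ∣)
    (centred-≤ {m} {r₀} c₀) (centred-≤ {m} {r₁} c₁) (centred-≤ {m} {r₂} c₂) (centred-≤ {m} {r₃} c₃)
  classify : Centred m r₀ → Centred m r₁ → Centred m r₂ → Centred m r₃ → Reduced m (quat r₀ r₁ r₂ r₃)
  classify (inj₁ s) _ _ _ = inj₁ (small (inj₁ s))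
  classify _ (inj₁ s) _ _ = inj₁ (small (inj₂ (inj₁ s)))
  classify _ _ (inj₁ s) _ = inj₁ (small (inj₂ (inj₂ (inj₁ s))))
  classify _ _ _ (inj₁ s) = inj₁ (small (inj₂ (inj₂ (inj₂ s))))
  classify (inj₂ (e₀ , h+h≡m)) (inj₂ (e₁ , _)) (inj₂ (e₂ , _)) (inj₂ (e₃ , _)) =
    inj₂ (≃⇒≡ (e₀ , e₁ , e₂ , e₃) , h+h≡m)

reduce : ∀ m .{{_ : ℕ.NonZero m}} q → ∃₂ λ r t → q ≡ r ⊕ + m ⋆ t × Reduced m r
reduce m (quat x₀ x₁ x₂ x₃)
  with centred-residue x₀ m | centred-residue x₁ m | centred-residue x₂ m | centred-residue x₃ m
... | r₀ , t₀ , e₀ , c₀ | r₁ , t₁ , e₁ , c₁ | r₂ , t₂ , e₂ , c₂ | r₃ , t₃ , e₃ , c₃ =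
  quat r₀ r₁ r₂ r₃ , quat t₀ t₁ t₂ t₃ , ≃⇒≡ (e₀ , e₁ , e₂ , e₃) , reduced r₀ r₁ r₂ r₃ c₀ c₁ c₂ c₃

norm-⊕⋆ : ∀ r n t → ∃ λ y → norm (r ⊕ n ⋆ t) ≡ norm r + n * y
norm-⊕⋆ (quat a b c d) n (quat x y z w) = _ , trans
  (cong₂ _+_ (cong₂ _+_ (cong₂ _+_ (square-shift a n x) (square-shift b n y)) (square-shift c n z))
             (square-shift d n w))
  (regroup (sq a) (sq b) (sq c) (sq d) _ _ _ _ n)
  where
  square-shift : ∀ r n t → (r + n * t) * (r + n * t) ≡ r * r + n * (t * (r + r + n * t))
  square-shift = solve-∀
  regroup : ∀ a b c d x y z w n →
            a + n * x + (b + n * y) + (c + n * z) + (d + n * w) ≡ a + b + c + d + n * (x + y + z + w)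
  regroup = solve-∀

residue-norm-divisible : ∀ {m} r t A → + m * A ≡ norm (r ⊕ + m ⋆ t) → m ℕ.∣ normℕ r
residue-norm-divisible {m} r t A mA≡N with norm-⊕⋆ r (+ m) t
... | y , shifted = subst (m ℕ.∣_) (cong ∣_∣ (norm≡normℕ r)) (∣⇒∣ᵤ m∣Nr)
  where
  m∣Nr+my : + m Signed.∣ norm r + + m * y
  m∣Nr+my = Signed.divides A (trans (sym shifted) (trans (sym mA≡N) (*-comm (+ m) A)))
  m∣Nr : + m Signed.∣ norm r
  m∣Nr = ∣m+n∣n⇒∣m m∣Nr+my (∣m⇒∣m*n y Signed.∣-refl)

IsNorm : ℕ → Set
IsNorm m = ∃ λ α → norm α ≡ + m

LeftFactor : ℕ → Quaternion → Set
LeftFactor m q = ∃₂ λ α β → norm α ≡ + m × q ≡ conj α · β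

Splits : ℕ → Set
Splits m = ∀ q A → + m * A ≡ norm q → LeftFactor m q

Below : ℕ → Set
Below m = ∀ {k} .{{_ : ℕ.NonZero k}} → k ℕ.< m → IsNorm k × Splits k

isNorm-* : ∀ {m n} → IsNorm m → IsNorm n → IsNorm (m ℕ.* n)
isNorm-* {m} {n} (α , Nα) (β , Nβ) = α · β , trans (norm-· α β) (trans (cong₂ _*_ Nα Nβ) (sym (pos-* m n)))

⋆-as-left-multiple : ∀ {m} α t → norm α ≡ + m → + m ⋆ t ≡ conj α · (α · t)
⋆-as-left-multiple α t Nα = trans (cong (_⋆ t) (sym Nα)) (sym (conj-·-· α t))

left-factor-⊕⋆ : ∀ {m r} t → LeftFactor m r → LeftFactor m (r ⊕ + m ⋆ t)
left-factor-⊕⋆ {m} t (α , u , Nα , refl) = α , u ⊕ α · t , Nα , (begin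
  conj α · u ⊕ + m ⋆ t          ≡⟨ cong (conj α · u ⊕_) (⋆-as-left-multiple α t Nα) ⟩
  conj α · u ⊕ conj α · (α · t) ≡⟨ ≃⇒≡ (·-distribˡ-⊕ (conj α) u (α · t)) ⟨
  conj α · (u ⊕ α · t)          ∎)

left-factor-by-conj : ∀ {k m} .{{_ : ℕ.NonZero k}} → Splits k → ∀ r → norm r ≡ + k * + m → LeftFactor m r
left-factor-by-conj {k} {m} k-splits r Nr≡km
  with k-splits (conj r) (+ m) (trans (sym Nr≡km) (sym (norm-conj r)))
... | γ , δ , Nγ , r̄≡γ̄δ = δ , γ , Nδ , r≡δ̄γ
  where
  r≡δ̄γ : r ≡ conj δ · γ
  r≡δ̄γ = begin
    r                      ≡⟨ ≃⇒≡ (conj-involutive r) ⟨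
    conj (conj r)          ≡⟨ cong conj r̄≡γ̄δ ⟩
    conj (conj γ · δ)      ≡⟨ ≃⇒≡ (conj-· (conj γ) δ) ⟩
    conj δ · conj (conj γ) ≡⟨ cong (conj δ ·_) (≃⇒≡ (conj-involutive γ)) ⟩
    conj δ · γ             ∎
  Nδ : norm δ ≡ + m
  Nδ = *-cancelʳ-≡ (norm δ) (+ m) (+ k) (begin
    norm δ * + k           ≡⟨ cong₂ _*_ (norm-conj δ) Nγ ⟨
    norm (conj δ) * norm γ ≡⟨ norm-· (conj δ) γ ⟨
    norm (conj δ · γ)      ≡⟨ cong norm r≡δ̄γ ⟨
    norm r                 ≡⟨ Nr≡km ⟩
    + k * + m              ≡⟨ *-comm (+ k) (+ m) ⟩
    + m * + k              ∎)

left-factor-diag : ∀ {n} → IsNorm n → LeftFactor (n ℕ.+ n) (diag (+ n))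
left-factor-diag {n} (γ , Nγ) = γ · ρ , γ · ε , Nγρ , sym (begin
  conj (γ · ρ) · (γ · ε)      ≡⟨ cong (_· (γ · ε)) (≃⇒≡ (conj-· γ ρ)) ⟩
  conj ρ · conj γ · (γ · ε)   ≡⟨ ≃⇒≡ (·-assoc (conj ρ) (conj γ) (γ · ε)) ⟩
  conj ρ · (conj γ · (γ · ε)) ≡⟨ cong (conj ρ ·_) (conj-·-· γ ε) ⟩
  conj ρ · (norm γ ⋆ ε)       ≡⟨ ≃⇒≡ (·-⋆ (norm γ) (conj ρ) ε) ⟩
  norm γ ⋆ (conj ρ · ε)       ≡⟨ cong (_⋆ diag 1ℤ) Nγ ⟩
  + n ⋆ diag 1ℤ               ≡⟨ ≃⇒≡ (*-identityʳ (+ n) , *-identityʳ (+ n) , *-identityʳ (+ n) , *-identityʳ (+ n)) ⟩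
  diag (+ n)                  ∎)
  where
  -- ρ = 1 + i has norm 2, and ε is chosen so that conj ρ · ε = diag 1ℤ.
  ρ ε : Quaternion
  ρ = quat 1ℤ 1ℤ 0ℤ 0ℤ
  ε = quat 0ℤ 1ℤ 1ℤ 0ℤ
  Nγρ : norm (γ · ρ) ≡ + (n ℕ.+ n)
  Nγρ = begin
    norm (γ · ρ) ≡⟨ norm-· γ ρ ⟩
    norm γ * + 2 ≡⟨ cong (_* + 2) Nγ ⟩
    + n * + 2    ≡⟨ pos-* n 2 ⟨
    + (n ℕ.* 2)  ≡⟨ cong +_ (double n) ⟩
    + (n ℕ.+ n)  ∎
    where
    double : ∀ n → n ℕ.* 2 ≡ n ℕ.+ n
    double = ℕ-Solver.solve-∀

small-residue : ∀ {m} → Below m → ∀ r → normℕ r ℕ.< m ℕ.* m → m ℕ.∣ normℕ r → r ≡ real 0ℤ ⊎ LeftFactor m r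
small-residue below r _ (divides zero Nr≡0) = inj₁ (normℕ≡0⇒≡0 r Nr≡0)
small-residue {m} below r Nr<m² (divides k@(suc _) Nr≡km) =
  inj₂ (left-factor-by-conj (proj₂ (below k<m)) r (trans (norm≡normℕ r) (trans (cong +_ Nr≡km) (pos-* k m))))
  where
  k<m : k ℕ.< m
  k<m = ℕ.*-cancelʳ-< m k m (subst (ℕ._< m ℕ.* m) Nr≡km Nr<m²)

descent : ∀ {m} .{{_ : ℕ.NonZero m}} → Below m → ∀ q A → + m * A ≡ norm q →
          (∃ λ t → q ≡ + m ⋆ t) ⊎ LeftFactor m q
descent {m} below q A mA≡Nq with reduce m q
... | r , t , refl , inj₂ (refl , h+h≡m) =
  inj₂ (subst (λ n → LeftFactor n (diag (+ h) ⊕ + n ⋆ t)) h+h≡m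
              (left-factor-⊕⋆ t (left-factor-diag (proj₁ (below h<m)))))
  where
  h = ⌊ m /2⌋
  instance
    h≢0 : ℕ.NonZero h
    h≢0 = ℕ.≢-nonZero λ h≡0 → ℕ.≢-nonZero⁻¹ m (trans (sym h+h≡m) (cong (λ x → x ℕ.+ x) h≡0))
  h<m : h ℕ.< m
  h<m = subst (h ℕ.<_) h+h≡m (ℕ.m<m+n h (ℕ.>-nonZero⁻¹ h))
... | r , t , refl , inj₁ Nr<m² with small-residue below r Nr<m² (residue-norm-divisible r t A mA≡Nq)
...   | inj₁ refl     = inj₁ (t , ⊕-identityˡ (+ m ⋆ t))
...   | inj₂ r-factor = inj₂ (left-factor-⊕⋆ t r-factor)

isNorm⇒splits : ∀ {m} .{{_ : ℕ.NonZero m}} → Below m → IsNorm m → Splits m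
isNorm⇒splits below (α , Nα) q A mA≡Nq with descent below q A mA≡Nq
... | inj₁ (t , refl) = α , α · t , Nα , ⋆-as-left-multiple α t Nα
... | inj₂ q-factor   = q-factor

norm[1+xi+yj] : ∀ p j x y → x ℕ.* x ℕ.+ y ℕ.* y ℕ.+ 1 ≡ j ℕ.* p → + p * + j ≡ norm (quat 1ℤ (+ x) (+ y) 0ℤ)
norm[1+xi+yj] p j x y x²+y²+1≡jp = begin
  + p * + j                        ≡⟨ pos-* p j ⟨
  + (p ℕ.* j)                      ≡⟨ cong +_ (trans (ℕ.*-comm p j) (sym x²+y²+1≡jp)) ⟩
  + (x ℕ.* x ℕ.+ y ℕ.* y ℕ.+ 1)    ≡⟨ cong +_ (rearrange x y) ⟩
  + normℕ (quat 1ℤ (+ x) (+ y) 0ℤ) ≡⟨ norm≡normℕ (quat 1ℤ (+ x) (+ y) 0ℤ) ⟨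
  norm (quat 1ℤ (+ x) (+ y) 0ℤ)    ∎
  where
  rearrange : ∀ x y → x ℕ.* x ℕ.+ y ℕ.* y ℕ.+ 1 ≡ 1 ℕ.* 1 ℕ.+ x ℕ.* x ℕ.+ y ℕ.* y ℕ.+ 0 ℕ.* 0
  rearrange = ℕ-Solver.solve-∀

prime-isNorm : ∀ {p} .{{_ : ℕ.NonZero p}} → Below p → Prime p → IsNorm p
prime-isNorm {p} below p-prime = from-collision (prime⇒∣x²+y²+1 p-prime)
  where
  from-collision : (∃₂ λ x y → p ℕ.∣ x ℕ.* x ℕ.+ y ℕ.* y ℕ.+ 1) → IsNorm p
  from-collision (x , y , divides j x²+y²+1≡jp)
    with descent below (quat 1ℤ (+ x) (+ y) 0ℤ) (+ j) (norm[1+xi+yj] p j x y x²+y²+1≡jp)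
  ... | inj₂ (α , _ , Nα , _) = α , Nα
  ... | inj₁ (quat t₀ _ _ _ , 1+xi+yj≡pt) = ⊥-elim (¬prime[1] (subst Prime p≡1 p-prime))
    where
    p≡1 : p ≡ 1
    p≡1 = ℕ.m*n≡1⇒m≡1 p ∣ t₀ ∣ (sym (trans (cong (λ q → ∣ re q ∣) 1+xi+yj≡pt) (abs-* (+ p) t₀)))

composite-isNorm : ∀ {m} .{{_ : ℕ.NonZero m}} → Below m → Composite m → IsNorm m
composite-isNorm below (composite {d} d<ed (divides-refl e)) = isNorm-* (proj₁ (below e<ed)) (proj₁ (below d<ed))
  where
  instance
    e≢0 : ℕ.NonZero e
    e≢0 = ℕ.m*n≢0⇒m≢0 e
    d≢0 : ℕ.NonZero d
    d≢0 = ℕ.nonTrivial⇒nonZero d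
  e<ed : e ℕ.< e ℕ.* d
  e<ed = ℕ.m<m*n e d (ℕ.nonTrivial⇒n>1 d)

isNorm-below : ∀ m .{{_ : ℕ.NonZero m}} → Below m → IsNorm m
isNorm-below 1 _ = quat 1ℤ 0ℤ 0ℤ 0ℤ , refl
isNorm-below m@(suc (suc _)) below with prime? m
... | yes m-prime = prime-isNorm below m-prime
... | no ¬m-prime = composite-isNorm below (¬prime⇒composite ¬m-prime)

isNorm×splits : ∀ m .{{_ : ℕ.NonZero m}} → IsNorm m × Splits m
isNorm×splits = <-rec (λ m → .{{_ : ℕ.NonZero m}} → IsNorm m × Splits m) step
  where
  step : ∀ m → (∀ {k} → k ℕ.< m → .{{_ : ℕ.NonZero k}} → IsNorm k × Splits k) →
         .{{_ : ℕ.NonZero m}} → IsNorm m × Splits m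
  step m rec = isNorm , isNorm⇒splits below isNorm
    where
    below : Below m
    below k<m = rec k<m
    isNorm : IsNorm m
    isNorm = isNorm-below m below

matrix-factorisation : ∀ m .{{_ : ℕ.NonZero m}} q A → + m * A ≡ norm q →
  ∃₂ λ α β → norm α ≡ + m × A ≡ norm β × matrix q ≡ₘ (transpose (matrix α) ⊗ matrix β)
matrix-factorisation m q A mA≡Nq with proj₂ (isNorm×splits m) q A mA≡Nq
... | α , β , Nα , refl = α , β , Nα , A≡Nβ , matrix-conj-· α β
  where
  A≡Nβ : A ≡ norm β
  A≡Nβ = *-cancelˡ-≡ (+ m) A (norm β) (begin
    + m * A                ≡⟨ mA≡Nq ⟩
    norm (conj α · β)      ≡⟨ norm-· (conj α) β ⟩
    norm (conj α) * norm β ≡⟨ cong (_* norm β) (trans (norm-conj α) Nα) ⟩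
    + m * norm β           ∎)

mainTheorem1 : ((m : ℤ) → m > + 0 → SumOfFourSquares m)
    ×
    ((m A F G H K : ℤ) → m > + 0 →
    m * A ≡ sq F + sq G + sq H + sq K →
    ∃ λ a → ∃ λ b → ∃ λ c → ∃ λ d →
    ∃ λ x → ∃ λ y → ∃ λ z → ∃ λ v →
    (m ≡ sq a + sq b + sq c + sq d)
    × (A ≡ sq x + sq y + sq z + sq v)
    × (M F G H K ≡ₘ (transpose (M a b c d) ⊗ M x y z v)))
mainTheorem1 =
  (λ where
    (+ zero) (+<+ ())
    (+ suc n) _ → case proj₁ (isNorm×splits (suc n)) of λ where
      (quat a b c d , Nα) → a , b , c , d , sym Nα)
  , λ where
    (+ zero) _ _ _ _ _ (+<+ ()) _
    (+ suc n) A F G H K _ mA≡N → case matrix-factorisation (suc n) (quat F G H K) A mA≡N of λ where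
      (quat a b c d , quat x y z v , Nα , A≡Nβ , M≡) → a , b , c , d , x , y , z , v , sym Nα , A≡Nβ , M≡
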